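{- Let $n$ be a non-negative integer. Then there is a unique element $\varepsilon\in\Omega(\mathrm{odd})$ such that $\|\varepsilon\|_{\mathrm{Fib}}=n$. Furthermore there is a unique element $\varepsilon\in\Omega(\mathrm{even})$ such that $\|\varepsilon\|_{\mathrm{Fib}}=n$.
   Context: For $k\ge1$, $\Omega(k)$ is the set of down-up zero-one sequences $(\varepsilon_{k-1},\dots,\varepsilon_0)$ with $\varepsilon_{k-1}\ge\varepsilon_{k-2}\le\varepsilon_{k-3}\ge\cdots\varepsilon_0$; $\Omega(0)$ consists of a single (zero) sequence of value $0$. For each $k$, identify $\Omega(k)$ with its image in $\Omega(k+2)$ under $\varepsilon\mapsto(0,0,\varepsilon)$ (prepending two zeros). $\Omega(\mathrm{even}):=\bigcup_{i\ge0}\Omega(2i)$ and $\Omega(\mathrm{odd}):=\bigcup_{i\ge0}\Omega(2i+1)$, under these identifications. For an integer sequence $V=(v_{k-1},\dots,v_0)$, $\|V\|_{\mathrm{Fib}}:=\sum_{i=0}^{k-1}v_i\,\mathrm{Fib}(i+1)$, where $\mathrm{Fib}(0)=0,\mathrm{Fib}(1)=1,\mathrm{Fib}(n)=\mathrm{Fib}(n-1)+\mathrm{Fib}(n-2)$. -}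

module Defs where

open import Data.Nat using (ℕ; zero; suc; _+_; _*_; _≤_)
open import Data.Vec using (Vec; []; _∷_)
open import Data.Vec.Relation.Unary.All using (All)
open import Data.Unit using (⊤)
open import Data.Product using (Σ; _×_; _,_; proj₂)
open import Data.Sum using (_⊎_)
open import Relation.Binary.PropositionalEquality using (_≡_)

fib : ℕ → ℕ
fib zero = zero
fib (suc zero) = suc zero
fib (suc (suc n)) = fib (suc n) + fib n

-- A sequence (ε_{k-1}, …, ε_0) is stored as a Vec ℕ k whose head is ε_{k-1}.

-- ‖V‖_Fib = Σ_{i=0}^{k-1} v_i Fib(i+1); the head v_{k-1} has weight Fib k.
fibNorm : ∀ {k} → Vec ℕ k → ℕ
fibNorm [] = 0
fibNorm {suc k} (v ∷ vs) = v * fib (suc k) + fibNorm vs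

DownFrom : ∀ {k} → Vec ℕ k → Set
UpFrom   : ∀ {k} → Vec ℕ k → Set
DownFrom [] = ⊤
DownFrom (x ∷ []) = ⊤
DownFrom (x ∷ y ∷ r) = (y ≤ x) × UpFrom (y ∷ r)
UpFrom [] = ⊤
UpFrom (x ∷ []) = ⊤
UpFrom (x ∷ y ∷ r) = (x ≤ y) × DownFrom (y ∷ r)

record Ω (k : ℕ) : Set where
  constructor mkΩ
  field
    seq     : Vec ℕ k
    zeroOne : All (λ x → x ≤ 1) seq
    downUp  : DownFrom seq
open Ω public

Ωodd : Set
Ωodd = Σ ℕ (λ i → Ω (suc (2 * i)))

Ωeven : Set
Ωeven = Σ ℕ (λ i → Ω (2 * i))

data PadOf : ∀ {m n} → Vec ℕ m → Vec ℕ n → Set where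
  here  : ∀ {m} {v : Vec ℕ m} → PadOf v v
  there : ∀ {m n} {v : Vec ℕ m} {w : Vec ℕ n} → PadOf v w → PadOf v (0 ∷ 0 ∷ w)

-- Equality in the union Ω(odd) / Ω(even) under the identifications ε ↦ (0,0,ε).
Identified : ∀ {m n} → Vec ℕ m → Vec ℕ n → Set
Identified v w = PadOf v w ⊎ PadOf w v

_≈odd_ : Ωodd → Ωodd → Set
e ≈odd f = Identified (seq (proj₂ e)) (seq (proj₂ f))

_≈even_ : Ωeven → Ωeven → Set
e ≈even f = Identified (seq (proj₂ e)) (seq (proj₂ f))

{-# OPTIONS --safe #-}
-- Read from the top in pairs, a down-up zero-one sequence is a string of blocks 00, 10, 11
-- in which a 11 must be followed by a 1.  Sequences of length k have norm below Fib(k+2),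
-- so if the leading pair of a sequence of length k+2 has digit sum s ∈ {0,1,2}, its norm
-- lies in [s F, (s+1) F) with F = Fib(k+2).  The leading pair is therefore read off the
-- norm: greedy expansion exists and is unique among sequences of one length.  Prepending 00
-- changes neither validity nor norm, while a sequence that is longer by an even amount and
-- starts with 1 has too large a norm; so equal norms force equality up to padding.
module Submission where

open import Defs
open import Data.Nat using (ℕ; zero; suc; _+_; _*_; _∸_; _≤_; _<_; _≤′_; ≤′-refl; ≤′-step; z≤n; s≤s; _<?_; NonZero; >-nonZero)
open import Data.Nat.Properties
open import Data.Vec using (Vec; []; _∷_)
open import Data.Vec.Relation.Unary.All using (All; []; _∷_)
open import Data.Unit using (tt)
open import Data.Product using (Σ; _×_; _,_; proj₂)
open import Data.Sum using (_⊎_; inj₁; inj₂)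
import Data.Sum as Sum
open import Function using (_∘_)
open import Relation.Binary.PropositionalEquality
open import Relation.Nullary using (Dec; yes; no; contradiction)

private
  variable
    k m n : ℕ
    a b a′ b′ : ℕ

fib[n]≤fib[1+n] : ∀ n → fib n ≤ fib (suc n)
fib[n]≤fib[1+n] zero = z≤n
fib[n]≤fib[1+n] (suc zero) = ≤-refl
fib[n]≤fib[1+n] (suc (suc n)) = m≤m+n _ _

fib-mono-≤ : m ≤ n → fib m ≤ fib n
fib-mono-≤ = go ∘ ≤⇒≤′
  where
  go : m ≤′ n → fib m ≤ fib n
  go ≤′-refl = ≤-refl
  go (≤′-step {n} p) = ≤-trans (go p) (fib[n]≤fib[1+n] n)

0<fib[1+n] : ∀ n → 0 < fib (suc n)
0<fib[1+n] zero = s≤s z≤n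
0<fib[1+n] (suc n) = ≤-trans (0<fib[1+n] n) (m≤m+n _ _)

fib[1+n]-nonZero : ∀ n → NonZero (fib (suc n))
fib[1+n]-nonZero n = >-nonZero (0<fib[1+n] n)

n<fib[2+n] : ∀ n → n < fib (2 + n)
n<fib[2+n] zero = s≤s z≤n
n<fib[2+n] (suc n) =
  subst (_≤ fib (3 + n)) (+-comm (suc n) 1) (+-mono-≤ (n<fib[2+n] n) (0<fib[1+n] n))

n≤k⇒n<fib[2+k] : n ≤ k → n < fib (2 + k)
n≤k⇒n<fib[2+k] {n} n≤k = <-≤-trans (n<fib[2+n] n) (fib-mono-≤ (s≤s (s≤s n≤k)))

fibNorm-1∷ : (v : Vec ℕ k) → fibNorm (1 ∷ v) ≡ fib (suc k) + fibNorm v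
fibNorm-1∷ {k} v = cong (_+ fibNorm v) (*-identityˡ (fib (suc k)))

fibNorm-1∷1∷ : (v : Vec ℕ k) → fibNorm (1 ∷ 1 ∷ v) ≡ fib (2 + k) + (fib (1 + k) + fibNorm v)
fibNorm-1∷1∷ {k} v = trans (fibNorm-1∷ (1 ∷ v)) (cong (fib (2 + k) +_) (fibNorm-1∷ v))

fibNorm-∷∷-cancel : ∀ a b (v w : Vec ℕ k) →
  fibNorm (a ∷ b ∷ v) ≡ fibNorm (a ∷ b ∷ w) → fibNorm v ≡ fibNorm w
fibNorm-∷∷-cancel {k} a b _ _ = +-cancelˡ-≡ (b * fib (suc k)) _ _ ∘ +-cancelˡ-≡ (a * fib (2 + k)) _ _

data _≤Head_ (x : ℕ) : Vec ℕ k → Set where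
  []  : x ≤Head []
  _∷_ : ∀ {y} → x ≤ y → (v : Vec ℕ k) → x ≤Head (y ∷ v)

-- Membership in Ω k, read two entries at a time from the head; after a pair 11 the
-- condition ε ≤ (next entry) is the vacuous-on-[] predicate 1 ≤Head v.
data DownUp : Vec ℕ k → Set where
  []  : DownUp []
  [0] : DownUp (0 ∷ [])
  [1] : DownUp (1 ∷ [])
  00∷ : {v : Vec ℕ k} → DownUp v → DownUp (0 ∷ 0 ∷ v)
  10∷ : {v : Vec ℕ k} → DownUp v → DownUp (1 ∷ 0 ∷ v)
  11∷ : {v : Vec ℕ k} → 1 ≤Head v → DownUp v → DownUp (1 ∷ 1 ∷ v)

UpFrom⇒DownFrom : ∀ {x} (v : Vec ℕ k) → UpFrom (x ∷ v) → DownFrom v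
UpFrom⇒DownFrom [] _ = tt
UpFrom⇒DownFrom (_ ∷ _) (_ , down) = down

UpFrom⇒≤Head : ∀ {x} (v : Vec ℕ k) → UpFrom (x ∷ v) → x ≤Head v
UpFrom⇒≤Head [] _ = []
UpFrom⇒≤Head (_ ∷ v) (x≤y , _) = x≤y ∷ v

0≤Head : (v : Vec ℕ k) → 0 ≤Head v
0≤Head [] = []
0≤Head (_ ∷ v) = z≤n ∷ v

≤Head⇒UpFrom : ∀ {x} {v : Vec ℕ k} → x ≤Head v → DownFrom v → UpFrom (x ∷ v)
≤Head⇒UpFrom [] _ = tt
≤Head⇒UpFrom (x≤y ∷ _) down = x≤y , down

Ω⇒DownUp : (e : Ω k) → DownUp (seq e)
Ω⇒DownUp (mkΩ v bits down) = go v bits down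
  where
  go : (v : Vec ℕ k) → All (_≤ 1) v → DownFrom v → DownUp v
  go [] [] _ = []
  go (_ ∷ []) (z≤n ∷ []) _ = [0]
  go (_ ∷ []) (s≤s z≤n ∷ []) _ = [1]
  go (_ ∷ _ ∷ v) (z≤n ∷ z≤n ∷ bits) (_ , up) = 00∷ (go v bits (UpFrom⇒DownFrom v up))
  go (_ ∷ _ ∷ v) (z≤n ∷ s≤s z≤n ∷ _) (() , _)
  go (_ ∷ _ ∷ v) (s≤s z≤n ∷ z≤n ∷ bits) (_ , up) = 10∷ (go v bits (UpFrom⇒DownFrom v up))
  go (_ ∷ _ ∷ v) (s≤s z≤n ∷ s≤s z≤n ∷ bits) (_ , up) =
    11∷ (UpFrom⇒≤Head v up) (go v bits (UpFrom⇒DownFrom v up))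

DownUp⇒zeroOne : {v : Vec ℕ k} → DownUp v → All (_≤ 1) v
DownUp⇒zeroOne [] = []
DownUp⇒zeroOne [0] = z≤n ∷ []
DownUp⇒zeroOne [1] = ≤-refl ∷ []
DownUp⇒zeroOne (00∷ d) = z≤n ∷ z≤n ∷ DownUp⇒zeroOne d
DownUp⇒zeroOne (10∷ d) = ≤-refl ∷ z≤n ∷ DownUp⇒zeroOne d
DownUp⇒zeroOne (11∷ _ d) = ≤-refl ∷ ≤-refl ∷ DownUp⇒zeroOne d

DownUp⇒DownFrom : {v : Vec ℕ k} → DownUp v → DownFrom v
DownUp⇒DownFrom [] = tt
DownUp⇒DownFrom [0] = tt
DownUp⇒DownFrom [1] = tt
DownUp⇒DownFrom (00∷ d) = z≤n , ≤Head⇒UpFrom (0≤Head _) (DownUp⇒DownFrom d)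
DownUp⇒DownFrom (10∷ d) = z≤n , ≤Head⇒UpFrom (0≤Head _) (DownUp⇒DownFrom d)
DownUp⇒DownFrom (11∷ h d) = ≤-refl , ≤Head⇒UpFrom h (DownUp⇒DownFrom d)

DownUp⇒Ω : {v : Vec ℕ k} → DownUp v → Ω k
DownUp⇒Ω {v = v} d = mkΩ v (DownUp⇒zeroOne d) (DownUp⇒DownFrom d)

fibNorm<fib : {v : Vec ℕ k} → DownUp v → fibNorm v < fib (2 + k)
fibNorm<fib [] = s≤s z≤n
fibNorm<fib [0] = s≤s z≤n
fibNorm<fib [1] = s≤s (s≤s z≤n)
fibNorm<fib {k = suc (suc k)} (00∷ d) =
  <-≤-trans (fibNorm<fib d) (fib-mono-≤ (m≤n+m (2 + k) 2))
fibNorm<fib {k = suc (suc k)} {1 ∷ 0 ∷ v} (10∷ d) = begin-strict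
  fibNorm (1 ∷ 0 ∷ v)  ≡⟨ fibNorm-1∷ (0 ∷ v) ⟩
  F₂ + fibNorm v       <⟨ +-monoʳ-< F₂ (fibNorm<fib d) ⟩
  F₂ + F₂              ≤⟨ +-monoʳ-≤ F₂ (fib[n]≤fib[1+n] (2 + k)) ⟩
  F₂ + fib (3 + k)     ≡⟨ +-comm F₂ _ ⟩
  fib (4 + k)          ∎
  where open ≤-Reasoning; F₂ = fib (2 + k)
fibNorm<fib {k = suc (suc k)} {1 ∷ 1 ∷ v} (11∷ _ d) = begin-strict
  fibNorm (1 ∷ 1 ∷ v)          ≡⟨ fibNorm-1∷1∷ v ⟩
  F₂ + (fib (1 + k) + fibNorm v)  <⟨ +-monoʳ-< F₂ (+-monoʳ-< _ (fibNorm<fib d)) ⟩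
  F₂ + (fib (1 + k) + F₂)     ≡⟨ +-assoc F₂ (fib (1 + k)) F₂ ⟨
  fib (4 + k)                  ∎
  where open ≤-Reasoning; F₂ = fib (2 + k)

fib≤fibNorm : {v : Vec ℕ k} → 1 ≤Head v → fib k ≤ fibNorm v
fib≤fibNorm [] = z≤n
fib≤fibNorm {suc k} (_∷_ {y = y} 1≤y v) = begin
  fib (suc k)                    ≡⟨ *-identityˡ (fib (suc k)) ⟨
  1 * fib (suc k)                ≤⟨ *-monoˡ-≤ (fib (suc k)) 1≤y ⟩
  y * fib (suc k)                ≤⟨ m≤m+n _ (fibNorm v) ⟩
  y * fib (suc k) + fibNorm v    ∎
  where open ≤-Reasoning

fib≤fibNorm⇒1≤Head : {v : Vec ℕ k} → DownUp v → fib k ≤ fibNorm v → 1 ≤Head v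
fib≤fibNorm⇒1≤Head [] _ = []
fib≤fibNorm⇒1≤Head [1] _ = ≤-refl ∷ []
fib≤fibNorm⇒1≤Head (10∷ _) _ = ≤-refl ∷ _
fib≤fibNorm⇒1≤Head (11∷ _ _) _ = ≤-refl ∷ _
fib≤fibNorm⇒1≤Head (00∷ d) F≤n = contradiction F≤n (<⇒≱ (fibNorm<fib d))

fibNorm-leading-digit : {v : Vec ℕ k} → DownUp (a ∷ b ∷ v) →
  (a + b) * fib (2 + k) ≤ fibNorm (a ∷ b ∷ v) × fibNorm (a ∷ b ∷ v) < suc (a + b) * fib (2 + k)
fibNorm-leading-digit {k} {v = v} (00∷ d) = z≤n , (begin-strict
  fibNorm v   <⟨ fibNorm<fib d ⟩
  F₂          ≡⟨ *-identityˡ F₂ ⟨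
  1 * F₂      ∎)
  where open ≤-Reasoning; F₂ = fib (2 + k)
fibNorm-leading-digit {k} {v = v} (10∷ d) = lower , upper
  where
  open ≤-Reasoning
  F₂ = fib (2 + k)
  lower : 1 * F₂ ≤ fibNorm (1 ∷ 0 ∷ v)
  lower = m≤m+n (1 * F₂) (fibNorm v)
  upper : fibNorm (1 ∷ 0 ∷ v) < 2 * F₂
  upper = begin-strict
    fibNorm (1 ∷ 0 ∷ v)  ≡⟨ fibNorm-1∷ (0 ∷ v) ⟩
    F₂ + fibNorm v       <⟨ +-monoʳ-< F₂ (fibNorm<fib d) ⟩
    F₂ + F₂              ≡⟨ cong (F₂ +_) (*-identityˡ F₂) ⟨
    2 * F₂               ∎
fibNorm-leading-digit {k} {v = v} (11∷ h d) = lower , upper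
  where
  open ≤-Reasoning
  F₂ = fib (2 + k)
  F₁ = fib (1 + k)
  lower : 2 * F₂ ≤ fibNorm (1 ∷ 1 ∷ v)
  lower = begin
    2 * F₂                      ≡⟨ cong (F₂ +_) (*-identityˡ F₂) ⟩
    F₂ + (F₁ + fib k)           ≤⟨ +-monoʳ-≤ F₂ (+-monoʳ-≤ F₁ (fib≤fibNorm h)) ⟩
    F₂ + (F₁ + fibNorm v)       ≡⟨ fibNorm-1∷1∷ v ⟨
    fibNorm (1 ∷ 1 ∷ v)         ∎
  upper : fibNorm (1 ∷ 1 ∷ v) < 3 * F₂
  upper = begin-strict
    fibNorm (1 ∷ 1 ∷ v)         ≡⟨ fibNorm-1∷1∷ v ⟩
    F₂ + (F₁ + fibNorm v)       <⟨ +-monoʳ-< F₂ (+-mono-≤-< (fib[n]≤fib[1+n] (1 + k)) (fibNorm<fib d)) ⟩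
    F₂ + (F₂ + F₂)              ≡⟨ cong (λ x → F₂ + (F₂ + x)) (*-identityˡ F₂) ⟨
    3 * F₂                      ∎

quotient-unique : ∀ {s t x} d → s * d ≤ x → x < suc s * d → t * d ≤ x → x < suc t * d → s ≡ t
quotient-unique d sd≤x x<[1+s]d td≤x x<[1+t]d =
  ≤-antisym (below sd≤x x<[1+t]d) (below td≤x x<[1+s]d)
  where
  below : ∀ {s t x} → s * d ≤ x → x < suc t * d → s ≤ t
  below {s} {t} sd≤x x<[1+t]d = m<1+n⇒m≤n (*-cancelʳ-< d s (suc t) (≤-<-trans sd≤x x<[1+t]d))

leading-digit-≡ : {v w : Vec ℕ k} → DownUp (a ∷ b ∷ v) → DownUp (a′ ∷ b′ ∷ w) →
  fibNorm (a ∷ b ∷ v) ≡ fibNorm (a′ ∷ b′ ∷ w) → a + b ≡ a′ + b′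
leading-digit-≡ {k} dv dw eq with fibNorm-leading-digit dv | fibNorm-leading-digit dw
... | lo , hi | lo′ , hi′ =
  quotient-unique (fib (2 + k)) lo hi (≤-trans lo′ (≤-reflexive (sym eq))) (≤-trans (s≤s (≤-reflexive eq)) hi′)

fibNorm-injective : {v w : Vec ℕ k} → DownUp v → DownUp w → fibNorm v ≡ fibNorm w → v ≡ w
fibNorm-injective [] [] _ = refl
fibNorm-injective [0] [0] _ = refl
fibNorm-injective [0] [1] ()
fibNorm-injective [1] [0] ()
fibNorm-injective [1] [1] _ = refl
fibNorm-injective (00∷ dv) (00∷ dw) eq = cong (λ u → 0 ∷ 0 ∷ u) (fibNorm-injective dv dw eq)
fibNorm-injective {v = _ ∷ _ ∷ v} {_ ∷ _ ∷ w} (10∷ dv) (10∷ dw) eq =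
  cong (λ u → 1 ∷ 0 ∷ u) (fibNorm-injective dv dw (fibNorm-∷∷-cancel 1 0 v w eq))
fibNorm-injective {v = _ ∷ _ ∷ v} {_ ∷ _ ∷ w} (11∷ _ dv) (11∷ _ dw) eq =
  cong (λ u → 1 ∷ 1 ∷ u) (fibNorm-injective dv dw (fibNorm-∷∷-cancel 1 1 v w eq))
fibNorm-injective dv@(00∷ _) dw@(10∷ _) eq = contradiction (leading-digit-≡ dv dw eq) λ ()
fibNorm-injective dv@(00∷ _) dw@(11∷ _ _) eq = contradiction (leading-digit-≡ dv dw eq) λ ()
fibNorm-injective dv@(10∷ _) dw@(00∷ _) eq = contradiction (leading-digit-≡ dv dw eq) λ ()
fibNorm-injective dv@(10∷ _) dw@(11∷ _ _) eq = contradiction (leading-digit-≡ dv dw eq) λ ()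
fibNorm-injective dv@(11∷ _ _) dw@(00∷ _) eq = contradiction (leading-digit-≡ dv dw eq) λ ()
fibNorm-injective dv@(11∷ _ _) dw@(10∷ _) eq = contradiction (leading-digit-≡ dv dw eq) λ ()

data EvenGap (m : ℕ) : ℕ → Set where
  gap-refl : EvenGap m m
  gap-2+   : EvenGap m n → EvenGap m (2 + n)

EvenGap⇒≤ : EvenGap m n → m ≤ n
EvenGap⇒≤ gap-refl = ≤-refl
EvenGap⇒≤ (gap-2+ g) = ≤-trans (EvenGap⇒≤ g) (m≤n+m _ 2)

EvenGap-suc : EvenGap m n → EvenGap (suc m) (suc n)
EvenGap-suc gap-refl = gap-refl
EvenGap-suc (gap-2+ g) = gap-2+ (EvenGap-suc g)

EvenGap-double : m ≤ n → EvenGap (2 * m) (2 * n)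
EvenGap-double = go ∘ ≤⇒≤′
  where
  go : m ≤′ n → EvenGap (2 * m) (2 * n)
  go ≤′-refl = gap-refl
  go (≤′-step {n} p) = subst (EvenGap _) (sym (*-suc 2 n)) (gap-2+ (go p))

SameParity : ℕ → ℕ → Set
SameParity m n = EvenGap m n ⊎ EvenGap n m

double-sameParity : ∀ m n → SameParity (2 * m) (2 * n)
double-sameParity m n = Sum.map EvenGap-double EvenGap-double (≤-total m n)

fibNorm<fibNorm[1∷] : {v : Vec ℕ m} → m ≤ n → DownUp v → (u : Vec ℕ (suc n)) →
  fibNorm v < fibNorm (1 ∷ u)
fibNorm<fibNorm[1∷] {m} {n} {v} m≤n dv u = begin-strict
  fibNorm v       <⟨ fibNorm<fib dv ⟩
  fib (2 + m)     ≤⟨ fib-mono-≤ (s≤s (s≤s m≤n)) ⟩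
  fib (2 + n)     ≤⟨ fib≤fibNorm (≤-refl ∷ u) ⟩
  fibNorm (1 ∷ u) ∎
  where open ≤-Reasoning

fibNorm-injective-padded : {v : Vec ℕ m} {w : Vec ℕ n} → EvenGap m n →
  DownUp v → DownUp w → fibNorm v ≡ fibNorm w → PadOf v w
fibNorm-injective-padded gap-refl dv dw eq = subst (PadOf _) (fibNorm-injective dv dw eq) here
fibNorm-injective-padded (gap-2+ g) dv (00∷ dw) eq = there (fibNorm-injective-padded g dv dw eq)
fibNorm-injective-padded {w = _ ∷ w} (gap-2+ g) dv (10∷ _) eq =
  contradiction eq (<⇒≢ (fibNorm<fibNorm[1∷] (EvenGap⇒≤ g) dv w))
fibNorm-injective-padded {w = _ ∷ w} (gap-2+ g) dv (11∷ _ _) eq =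
  contradiction eq (<⇒≢ (fibNorm<fibNorm[1∷] (EvenGap⇒≤ g) dv w))

Expansion : ℕ → ℕ → Set
Expansion k n = Σ (Vec ℕ k) λ v → DownUp v × fibNorm v ≡ n

fibNorm-surjective : ∀ k n → n < fib (2 + k) → Expansion k n
fibNorm-surjective zero zero _ = [] , [] , refl
fibNorm-surjective zero (suc n) (s≤s ())
fibNorm-surjective 1 zero _ = _ , [0] , refl
fibNorm-surjective 1 1 _ = _ , [1] , refl
fibNorm-surjective 1 (suc (suc n)) (s≤s (s≤s ()))
fibNorm-surjective (suc (suc k)) n n<F₄ = by-leading-digit (n <? F₂) (r <? F₂)
  where
  open ≡-Reasoning
  F₂ = fib (2 + k)
  F₁ = fib (1 + k)
  r = n ∸ F₂

  by-leading-digit : Dec (n < F₂) → Dec (r < F₂) → Expansion (2 + k) n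
  by-leading-digit (yes n<F₂) _ with fibNorm-surjective k n n<F₂
  ... | v , d , eq = 0 ∷ 0 ∷ v , 00∷ d , eq
  by-leading-digit (no n≮F₂) (yes r<F₂) with fibNorm-surjective k r r<F₂
  ... | v , d , eq = 1 ∷ 0 ∷ v , 10∷ d , (begin
    fibNorm (1 ∷ 0 ∷ v)  ≡⟨ fibNorm-1∷ (0 ∷ v) ⟩
    F₂ + fibNorm v       ≡⟨ cong (F₂ +_) eq ⟩
    F₂ + r               ≡⟨ m+[n∸m]≡n (≮⇒≥ n≮F₂) ⟩
    n                    ∎)
  by-leading-digit (no n≮F₂) (no r≮F₂) with fibNorm-surjective k (r ∸ F₁) r∸F₁<F₂
    where
    r<F₁+F₂ : r < F₁ + F₂
    r<F₁+F₂ = subst (r <_) (+-comm F₂ F₁)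
      (m<n+o⇒m∸n<o n F₂ ⦃ fib[1+n]-nonZero (2 + k) ⦄ (subst (n <_) (+-comm _ F₂) n<F₄))
    r∸F₁<F₂ : r ∸ F₁ < F₂
    r∸F₁<F₂ = m<n+o⇒m∸n<o r F₁ ⦃ fib[1+n]-nonZero (1 + k) ⦄ r<F₁+F₂
  ... | v , d , eq = 1 ∷ 1 ∷ v , 11∷ (fib≤fibNorm⇒1≤Head d fib≤norm) d , (begin
    fibNorm (1 ∷ 1 ∷ v)     ≡⟨ fibNorm-1∷1∷ v ⟩
    F₂ + (F₁ + fibNorm v)   ≡⟨ cong (λ x → F₂ + (F₁ + x)) eq ⟩
    F₂ + (F₁ + (r ∸ F₁))    ≡⟨ cong (F₂ +_) (m+[n∸m]≡n F₁≤r) ⟩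
    F₂ + r                  ≡⟨ m+[n∸m]≡n (≮⇒≥ n≮F₂) ⟩
    n                       ∎)
    where
    F₂≤r : F₂ ≤ r
    F₂≤r = ≮⇒≥ r≮F₂
    F₁≤r : F₁ ≤ r
    F₁≤r = ≤-trans (fib[n]≤fib[1+n] (1 + k)) F₂≤r
    fib≤norm : fib k ≤ fibNorm v
    fib≤norm = subst (fib k ≤_) (sym eq) (m+n≤o⇒m≤o∸n (fib k) (subst (_≤ r) (+-comm F₁ (fib k)) F₂≤r))

fibNorm-identified : {v : Vec ℕ m} {w : Vec ℕ n} → SameParity m n →
  DownUp v → DownUp w → fibNorm v ≡ fibNorm w → Identified v w
fibNorm-identified (inj₁ g) dv dw eq = inj₁ (fibNorm-injective-padded g dv dw eq)
fibNorm-identified (inj₂ g) dv dw eq = inj₂ (fibNorm-injective-padded g dw dv (sym eq))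

⋃Ω : (ℕ → ℕ) → Set
⋃Ω len = Σ ℕ (Ω ∘ len)

⋃Ω-fibNorm-surjective : (len : ℕ → ℕ) → (∀ i → i ≤ len i) →
  ∀ n → Σ (⋃Ω len) λ e → fibNorm (seq (proj₂ e)) ≡ n
⋃Ω-fibNorm-surjective len i≤len n with fibNorm-surjective (len n) n (n≤k⇒n<fib[2+k] (i≤len n))
... | _ , d , eq = (n , DownUp⇒Ω d) , eq

⋃Ω-fibNorm-injective : (len : ℕ → ℕ) → (∀ i j → SameParity (len i) (len j)) →
  ∀ {n} (e f : ⋃Ω len) → fibNorm (seq (proj₂ e)) ≡ n → fibNorm (seq (proj₂ f)) ≡ n →
  Identified (seq (proj₂ e)) (seq (proj₂ f))
⋃Ω-fibNorm-injective len sameParity (i , e) (j , f) e≡n f≡n =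
  fibNorm-identified (sameParity i j) (Ω⇒DownUp e) (Ω⇒DownUp f) (trans e≡n (sym f≡n))

proposition7p4 : (n : ℕ) →
    (Σ Ωodd (λ e → fibNorm (seq (proj₂ e)) ≡ n)
      × ((e f : Ωodd) → fibNorm (seq (proj₂ e)) ≡ n → fibNorm (seq (proj₂ f)) ≡ n → e ≈odd f))
    × (Σ Ωeven (λ e → fibNorm (seq (proj₂ e)) ≡ n)
      × ((e f : Ωeven) → fibNorm (seq (proj₂ e)) ≡ n → fibNorm (seq (proj₂ f)) ≡ n → e ≈even f))
proposition7p4 n =
  (⋃Ω-fibNorm-surjective odd i≤odd n , ⋃Ω-fibNorm-injective odd odd-sameParity) ,
  (⋃Ω-fibNorm-surjective even i≤even n , ⋃Ω-fibNorm-injective even double-sameParity)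
  where
  odd even : ℕ → ℕ
  odd i = suc (2 * i)
  even i = 2 * i
  i≤even : ∀ i → i ≤ even i
  i≤even i = m≤m+n i (i + 0)
  i≤odd : ∀ i → i ≤ odd i
  i≤odd i = m≤n⇒m≤1+n (i≤even i)
  odd-sameParity : ∀ i j → SameParity (odd i) (odd j)
  odd-sameParity i j = Sum.map EvenGap-suc EvenGap-suc (double-sameParity i j)
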